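{- Let $d\ge1$ and let $t=(t_1,\dots,t_d)$, $u=(u_1,\dots,u_d)$ be transitions ($1$-cells) of the bulk $B^d$, with $k$ the unique index such that $t_k=\ast$ and $l$ the unique index such that $u_l=\ast$. Then $t\approx u$ if and only if $k=l$. Consequently $\mathcal U(B^d)$ is in bijection with $\{1,\dots,d\}$ (via the index of $\ast$), and under this bijection the relation $\lessdot$ on $\mathcal U(B^d)$ agrees with the natural order on $\{1,\dots,d\}$.
   Context: A precubical set has cells $Q_n$ and face maps $s_k,t_k:Q_n\to Q_{n-1}$ ($k=1,\dots,n$). The bulk $B^d$ is the precubical set whose $n$-cells are the tuples $(x_1,\dots,x_d)\in\{0,\ast,1\}^d$ with exactly $n$ entries equal to $\ast$; for such $x$ with $\ast$ exactly at positions $i_1<\dots<i_n$, $s_kx$ (resp. $t_kx$) is $x$ with entry $i_k$ replaced by $0$ (resp. $1$). For a precubical set $Q$, $\approx$ is the equivalence on $Q_1$ generated by $(s_iq,t_iq)$ for $q\in Q_2$, $i\in\{1,2\}$; $\mathcal U(Q)=Q_1/\approx$, $\lambda(e)$ is the class of $e$; $\lessdot$ is the transitive closure on $\mathcal U(Q)$ of $\{(\lambda(s_2q),\lambda(s_1q)):q\in Q_2\}$. -}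

module Defs where

open import Data.Nat using (ℕ; zero; suc)
open import Data.Nat.Properties using (suc-injective)
open import Data.Fin using (Fin; zero; suc)
open import Data.Vec using (Vec; []; _∷_)
open import Data.Bool using (Bool; true; false)
open import Data.Product using (Σ; _,_; proj₁; proj₂)
open import Relation.Binary.PropositionalEquality using (_≡_; refl; sym; trans; cong; subst)

data Tri : Set where
  O    : Tri
  star : Tri
  I    : Tri

stars : ∀ {d} → Vec Tri d → ℕ
stars [] = zero
stars (O ∷ xs) = stars xs
stars (star ∷ xs) = suc (stars xs)
stars (I ∷ xs) = stars xs

-- replace the k-th ∗ (0-based, counted from the left) by 0 (b = false) or 1 (b = true)
bit : Bool → Tri
bit false = O
bit true = I

face : ∀ {d} → Bool → (x : Vec Tri d) → Fin (stars x) → Vec Tri d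
face b (O ∷ xs) k = O ∷ face b xs k
face b (star ∷ xs) zero = bit b ∷ xs
face b (star ∷ xs) (suc k) = star ∷ face b xs k
face b (I ∷ xs) k = I ∷ face b xs k

stars-bit : ∀ b → ∀ {d} (xs : Vec Tri d) → stars (bit b ∷ xs) ≡ stars xs
stars-bit false xs = refl
stars-bit true xs = refl

stars-face : ∀ {d} b (x : Vec Tri d) (k : Fin (stars x)) → suc (stars (face b x k)) ≡ stars x
stars-face b (O ∷ xs) k = stars-face b xs k
stars-face b (star ∷ xs) zero = cong suc (stars-bit b xs)
stars-face b (star ∷ xs) (suc k) = cong suc (stars-face b xs k)
stars-face b (I ∷ xs) k = stars-face b xs k

Cell : ℕ → ℕ → Set
Cell d n = Σ (Vec Tri d) (λ x → stars x ≡ n)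

-- face maps; the index i : Fin (suc n) is 0-based, so i = zero is s_1 / t_1
faceCell : ∀ {d n} → Bool → Cell d (suc n) → Fin (suc n) → Cell d n
faceCell b (x , p) i =
  face b x (subst Fin (sym p) i) ,
  suc-injective (trans (stars-face b x (subst Fin (sym p) i)) p)

s : ∀ {d n} → Cell d (suc n) → Fin (suc n) → Cell d n
s = faceCell false

t : ∀ {d n} → Cell d (suc n) → Fin (suc n) → Cell d n
t = faceCell true

Q1 : ℕ → Set
Q1 d = Cell d 1

Q2 : ℕ → Set
Q2 d = Cell d 2

data _≈_ {d : ℕ} : Q1 d → Q1 d → Set where
  gen    : (q : Q2 d) (i : Fin 2) → s q i ≈ t q i
  ≈refl  : (e : Q1 d) → e ≈ e
  ≈sym   : ∀ {e e'} → e ≈ e' → e' ≈ e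
  ≈trans : ∀ {e e' e''} → e ≈ e' → e' ≈ e'' → e ≈ e''

-- ⋖ lifted to representatives: λ(e) ⋖ λ(e') iff e ⋖ e', where ⋖ is the transitive
-- closure of {(λ(s_2 q), λ(s_1 q)) : q ∈ Q2} on U(B^d) = Q1/≈
data _⋖_ {d : ℕ} : Q1 d → Q1 d → Set where
  step   : ∀ {e e'} (q : Q2 d) → e ≈ s q (suc zero) → s q zero ≈ e' → e ⋖ e'
  ⋖trans : ∀ {e e' e''} → e ⋖ e' → e' ⋖ e'' → e ⋖ e''

module Submission where

-- Transitions of the bulk B^d are the vectors in {0,∗,1}^d with exactly one ∗;
-- the position of that ∗ is the axis of the transition.  We prove:
--
--  (1) ≈ preserves the axis: the two faces s_k q, t_k q of a 2-cell differ only
--      in the entry replacing the k-th ∗ of q, so they keep the same ∗.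
--  (2) transitions with the same axis k are ≈: two vectors differing in a single
--      entry 0/1 are opposite faces of one higher cell, and the equivalence
--      closure of this adjacency connects every transition of axis k to the
--      basis transition e_k (∗ at k, 0 elsewhere).
--  (3) for a 2-cell q with ∗ at positions a < c, s_2 q has axis a and s_1 q has
--      axis c; conversely every pair a < c arises from such a 2-cell.  Hence the
--      generating pairs of ⋖ are exactly the pairs of axes a < c, and ⋖ is < on
--      axes.

open import Defs
open import Data.Nat using (ℕ; _≤_; zero; suc; z<s; s<s)
open import Data.Nat.Properties using (≡-irrelevant; <-trans; suc-injective)
open import Data.Fin using (Fin; _<_; toℕ; zero; suc)
open import Data.Fin.Properties using (subst-is-cast; toℕ-cast)
open import Data.Vec using (Vec; []; _∷_; lookup; replicate)
open import Data.Bool using (Bool; true; false)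
open import Data.Empty using (⊥; ⊥-elim)
open import Data.Product using (Σ; ∃; _×_; proj₁; proj₂; _,_)
open import Function.Bundles using (_⇔_; mk⇔)
open import Relation.Binary.PropositionalEquality
  using (_≡_; refl; sym; trans; cong; subst; subst₂)
open import Relation.Binary.PropositionalEquality.Properties using (subst-sym-subst)
open import Relation.Binary.Construct.Closure.Symmetric using (fwd; bwd)
open import Relation.Binary.Construct.Closure.ReflexiveTransitive using (ε; _◅_; _◅◅_)
open import Relation.Binary.Construct.Closure.Equivalence using (EqClosure; gmap; symmetric)

toℕ-subst : ∀ {m n} (e : m ≡ n) (i : Fin m) → toℕ (subst Fin e i) ≡ toℕ i
toℕ-subst e i = trans (cong toℕ (subst-is-cast e i)) (toℕ-cast e i)

bit≢star : ∀ b → bit b ≡ star → ⊥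
bit≢star false ()
bit≢star true ()

starless : ∀ {d} (x : Vec Tri d) (k : Fin d) → stars x ≡ 0 → lookup x k ≡ star → ⊥
starless (O ∷ xs) zero e ()
starless (I ∷ xs) zero e ()
starless (star ∷ xs) k () x[k]≡∗
starless (O ∷ xs) (suc k) e x[k]≡∗ = starless xs k e x[k]≡∗
starless (I ∷ xs) (suc k) e x[k]≡∗ = starless xs k e x[k]≡∗

starPos : ∀ {d} (x : Vec Tri d) → stars x ≡ 1 → Fin d
starPos (star ∷ xs) p = zero
starPos (O ∷ xs) p = suc (starPos xs p)
starPos (I ∷ xs) p = suc (starPos xs p)

lookup-starPos : ∀ {d} (x : Vec Tri d) (p : stars x ≡ 1) → lookup x (starPos x p) ≡ star
lookup-starPos (star ∷ xs) p = refl
lookup-starPos (O ∷ xs) p = lookup-starPos xs p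
lookup-starPos (I ∷ xs) p = lookup-starPos xs p

starPos-unique : ∀ {d} (x : Vec Tri d) (p : stars x ≡ 1) (k : Fin d) →
  lookup x k ≡ star → starPos x p ≡ k
starPos-unique (star ∷ xs) p zero x[k]≡∗ = refl
starPos-unique (star ∷ xs) p (suc k) x[k]≡∗ = ⊥-elim (starless xs k (suc-injective p) x[k]≡∗)
starPos-unique (O ∷ xs) p (suc k) x[k]≡∗ = cong suc (starPos-unique xs p k x[k]≡∗)
starPos-unique (I ∷ xs) p (suc k) x[k]≡∗ = cong suc (starPos-unique xs p k x[k]≡∗)
starPos-unique (O ∷ xs) p zero ()
starPos-unique (I ∷ xs) p zero ()

axis : ∀ {d} → Q1 d → Fin d
axis (x , p) = starPos x p

zeros : ∀ d → Vec Tri d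
zeros d = replicate d O

basis : ∀ {d} → Fin d → Vec Tri d
basis {suc d} zero = star ∷ zeros d
basis (suc k) = O ∷ basis k

stars-zeros : ∀ d → stars (zeros d) ≡ 0
stars-zeros zero = refl
stars-zeros (suc d) = stars-zeros d

stars-basis : ∀ {d} (k : Fin d) → stars (basis k) ≡ 1
stars-basis {suc d} zero = cong suc (stars-zeros d)
stars-basis (suc k) = stars-basis k

lookup-basis : ∀ {d} (k : Fin d) → lookup (basis k) k ≡ star
lookup-basis zero = refl
lookup-basis (suc k) = lookup-basis k

-- (1) ≈ preserves the axis

faces-share-stars : ∀ {d} b b' (x : Vec Tri d) (k : Fin (stars x)) (j : Fin d) →
  lookup (face b x k) j ≡ star → lookup (face b' x k) j ≡ star
faces-share-stars b b' (O ∷ xs) k zero ()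
faces-share-stars b b' (O ∷ xs) k (suc j) ∗ = faces-share-stars b b' xs k j ∗
faces-share-stars b b' (I ∷ xs) k zero ()
faces-share-stars b b' (I ∷ xs) k (suc j) ∗ = faces-share-stars b b' xs k j ∗
faces-share-stars b b' (star ∷ xs) zero zero ∗ = ⊥-elim (bit≢star b ∗)
faces-share-stars b b' (star ∷ xs) zero (suc j) ∗ = ∗
faces-share-stars b b' (star ∷ xs) (suc k) zero ∗ = refl
faces-share-stars b b' (star ∷ xs) (suc k) (suc j) ∗ = faces-share-stars b b' xs k j ∗

≈⇒same-axis : ∀ {d} {u v : Q1 d} → u ≈ v → axis u ≡ axis v
≈⇒same-axis (gen (x , p) i) =
  sym (starPos-unique _ _ _ (faces-share-stars false true x k _ (lookup-starPos (proj₁ sq) (proj₂ sq))))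
  where
  k = subst Fin (sym p) i
  sq = s (x , p) i
≈⇒same-axis (≈refl e) = refl
≈⇒same-axis (≈sym r) = sym (≈⇒same-axis r)
≈⇒same-axis (≈trans r r') = trans (≈⇒same-axis r) (≈⇒same-axis r')

-- (2) transitions with the same axis are ≈

≈-cong : ∀ {d} {x x' y y' : Vec Tri d} {p q p' q'} → x ≡ x' → y ≡ y' →
  _≈_ {d} (x , p) (y , q) → _≈_ {d} (x' , p') (y' , q')
≈-cong {p = p} {q} {p'} {q'} refl refl r
  rewrite ≡-irrelevant p p' | ≡-irrelevant q q' = r

-- The generators of ≈, indexed directly by the ∗ of the 2-cell being replaced.
faces≈ : ∀ {d} (z : Vec Tri d) (r : stars z ≡ 2) (j : Fin (stars z)) p q →
  _≈_ {d} (face false z j , p) (face true z j , q)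
faces≈ z r j p q =
  ≈-cong (cong (face false z) (subst-sym-subst r)) (cong (face true z) (subst-sym-subst r))
    (gen (z , r) (subst Fin r j))

data Adj : {d : ℕ} → Vec Tri d → Vec Tri d → Set where
  here  : ∀ {d} (xs : Vec Tri d) → Adj (O ∷ xs) (I ∷ xs)
  there : ∀ {d} (c : Tri) {xs ys : Vec Tri d} → Adj xs ys → Adj (c ∷ xs) (c ∷ ys)

-- Adjacent vectors are the faces s_j z, t_j z of the cell z with ∗ at the changed entry.
Adj⇒faces : ∀ {d} {x y : Vec Tri d} → Adj x y →
  Σ (Vec Tri d) λ z → (suc (stars x) ≡ stars z) × Σ (Fin (stars z)) λ j →
    (face false z j ≡ x) × (face true z j ≡ y)
Adj⇒faces (here xs) = star ∷ xs , refl , zero , refl , refl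
Adj⇒faces (there O a) with Adj⇒faces a
... | z , e , j , sz≡x , tz≡y = O ∷ z , e , j , cong (O ∷_) sz≡x , cong (O ∷_) tz≡y
Adj⇒faces (there I a) with Adj⇒faces a
... | z , e , j , sz≡x , tz≡y = I ∷ z , e , j , cong (I ∷_) sz≡x , cong (I ∷_) tz≡y
Adj⇒faces (there star a) with Adj⇒faces a
... | z , e , j , sz≡x , tz≡y =
  star ∷ z , cong suc e , suc j , cong (star ∷_) sz≡x , cong (star ∷_) tz≡y

Adj-stars : ∀ {d} {x y : Vec Tri d} → Adj x y → stars x ≡ stars y
Adj-stars (here xs) = refl
Adj-stars (there O a) = Adj-stars a
Adj-stars (there I a) = Adj-stars a
Adj-stars (there star a) = cong suc (Adj-stars a)

-- Adjacent transitions are ≈ (they are opposite faces of a 2-cell).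
Adj⇒≈ : ∀ {d} {x y : Vec Tri d} → Adj x y → (p : stars x ≡ 1) (q : stars y ≡ 1) →
  _≈_ {d} (x , p) (y , q)
Adj⇒≈ a p q with Adj⇒faces a
... | z , e , j , sz≡x , tz≡y =
  ≈-cong sz≡x tz≡y
    (faces≈ z (trans (sym e) (cong suc p)) j
      (subst (λ w → stars w ≡ 1) (sym sz≡x) p) (subst (λ w → stars w ≡ 1) (sym tz≡y) q))

Connected : ∀ {d} → Vec Tri d → Vec Tri d → Set
Connected = EqClosure Adj

prepend : ∀ {d} (c : Tri) {x y : Vec Tri d} → Connected x y → Connected (c ∷ x) (c ∷ y)
prepend c = gmap (c ∷_) (there c)

-- Connected transitions are ≈; adjacency preserves the star count along the way.
Connected⇒≈ : ∀ {d} {x y : Vec Tri d} → Connected x y → (p : stars x ≡ 1) (q : stars y ≡ 1) →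
  _≈_ {d} (x , p) (y , q)
Connected⇒≈ ε p q = ≈-cong refl refl (≈refl (_ , p))
Connected⇒≈ (fwd a ◅ c) p q = ≈trans (Adj⇒≈ a p p') (Connected⇒≈ c p' q)
  where p' = trans (sym (Adj-stars a)) p
Connected⇒≈ (bwd a ◅ c) p q = ≈trans (≈sym (Adj⇒≈ a p' p)) (Connected⇒≈ c p' q)
  where p' = trans (Adj-stars a) p

connect-zeros : ∀ {d} (x : Vec Tri d) → stars x ≡ 0 → Connected x (zeros d)
connect-zeros [] e = ε
connect-zeros (O ∷ xs) e = prepend O (connect-zeros xs e)
connect-zeros (I ∷ xs) e = bwd (here xs) ◅ prepend O (connect-zeros xs e)
connect-zeros (star ∷ xs) ()

connect-basis : ∀ {d} (x : Vec Tri d) (k : Fin d) → stars x ≡ 1 → lookup x k ≡ star →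
  Connected x (basis k)
connect-basis (star ∷ xs) zero e x[k]≡∗ = prepend star (connect-zeros xs (suc-injective e))
connect-basis (star ∷ xs) (suc k) e x[k]≡∗ = ⊥-elim (starless xs k (suc-injective e) x[k]≡∗)
connect-basis (O ∷ xs) (suc k) e x[k]≡∗ = prepend O (connect-basis xs k e x[k]≡∗)
connect-basis (I ∷ xs) (suc k) e x[k]≡∗ =
  bwd (here xs) ◅ prepend O (connect-basis xs k e x[k]≡∗)
connect-basis (O ∷ xs) zero e ()
connect-basis (I ∷ xs) zero e ()

-- Both transitions are connected to the same basis transition e_k.
same-axis⇒≈ : ∀ {d} (u v : Q1 d) → axis u ≡ axis v → u ≈ v
same-axis⇒≈ (x , p) (y , q) e =
  Connected⇒≈ (connect-basis x k p (lookup-starPos x p) ◅◅ symmetric Adj (connect-basis y k q y[k]≡∗)) p q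
  where
  k = starPos x p
  y[k]≡∗ : lookup y k ≡ star
  y[k]≡∗ = subst (λ w → lookup y w ≡ star) (sym e) (lookup-starPos y q)

≈⇔same-axis : ∀ {d} (u v : Q1 d) → u ≈ v ⇔ axis u ≡ axis v
≈⇔same-axis u v = mk⇔ ≈⇒same-axis (same-axis⇒≈ u v)

-- (3) ⋖ is the order of axes

firstStar : ∀ {d} (x : Vec Tri d) → stars x ≡ 2 → Fin d
firstStar (star ∷ xs) p = zero
firstStar (O ∷ xs) p = suc (firstStar xs p)
firstStar (I ∷ xs) p = suc (firstStar xs p)

secondStar : ∀ {d} (x : Vec Tri d) → stars x ≡ 2 → Fin d
secondStar (star ∷ xs) p = suc (starPos xs (suc-injective p))
secondStar (O ∷ xs) p = suc (secondStar xs p)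
secondStar (I ∷ xs) p = suc (secondStar xs p)

firstStar<secondStar : ∀ {d} (x : Vec Tri d) (p : stars x ≡ 2) → firstStar x p < secondStar x p
firstStar<secondStar (star ∷ xs) p = z<s
firstStar<secondStar (O ∷ xs) p = s<s (firstStar<secondStar xs p)
firstStar<secondStar (I ∷ xs) p = s<s (firstStar<secondStar xs p)

face₂-keeps-first : ∀ {d} b (x : Vec Tri d) (p : stars x ≡ 2) (k : Fin (stars x)) →
  toℕ k ≡ 1 → lookup (face b x k) (firstStar x p) ≡ star
face₂-keeps-first b (star ∷ xs) p (suc k) k≡1 = refl
face₂-keeps-first b (O ∷ xs) p k k≡1 = face₂-keeps-first b xs p k k≡1
face₂-keeps-first b (I ∷ xs) p k k≡1 = face₂-keeps-first b xs p k k≡1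

face₁-keeps-second : ∀ {d} b (x : Vec Tri d) (p : stars x ≡ 2) (k : Fin (stars x)) →
  toℕ k ≡ 0 → lookup (face b x k) (secondStar x p) ≡ star
face₁-keeps-second b (star ∷ xs) p zero k≡0 = lookup-starPos xs (suc-injective p)
face₁-keeps-second b (O ∷ xs) p k k≡0 = face₁-keeps-second b xs p k k≡0
face₁-keeps-second b (I ∷ xs) p k k≡0 = face₁-keeps-second b xs p k k≡0

axis-s₂ : ∀ {d} (q : Q2 d) → axis (s q (suc zero)) ≡ firstStar (proj₁ q) (proj₂ q)
axis-s₂ (x , p) =
  starPos-unique _ _ _ (face₂-keeps-first false x p _ (toℕ-subst (sym p) (suc zero)))

axis-s₁ : ∀ {d} (q : Q2 d) → axis (s q zero) ≡ secondStar (proj₁ q) (proj₂ q)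
axis-s₁ (x , p) =
  starPos-unique _ _ _ (face₁-keeps-second false x p _ (toℕ-subst (sym p) zero))

-- Each generating pair of ⋖ goes from the axis firstStar q to the larger axis secondStar q.
⋖⇒< : ∀ {d} {u v : Q1 d} → u ⋖ v → axis u < axis v
⋖⇒< (step (x , p) u≈s₂q s₁q≈v) =
  subst₂ _<_ (sym (trans (≈⇒same-axis u≈s₂q) (axis-s₂ (x , p))))
             (trans (sym (axis-s₁ (x , p))) (≈⇒same-axis s₁q≈v))
             (firstStar<secondStar x p)
⋖⇒< (⋖trans r r') = <-trans (⋖⇒< r) (⋖⇒< r')

twoStars : ∀ {d} (a c : Fin d) → a < c → Vec Tri d
twoStars zero (suc c) h = star ∷ basis c
twoStars (suc a) (suc c) (s<s h) = O ∷ twoStars a c h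

stars-twoStars : ∀ {d} (a c : Fin d) (h : a < c) → stars (twoStars a c h) ≡ 2
stars-twoStars zero (suc c) h = cong suc (stars-basis c)
stars-twoStars (suc a) (suc c) (s<s h) = stars-twoStars a c h

firstStar-twoStars : ∀ {d} (a c : Fin d) (h : a < c) (p : stars (twoStars a c h) ≡ 2) →
  firstStar (twoStars a c h) p ≡ a
firstStar-twoStars zero (suc c) h p = refl
firstStar-twoStars (suc a) (suc c) (s<s h) p = cong suc (firstStar-twoStars a c h p)

secondStar-twoStars : ∀ {d} (a c : Fin d) (h : a < c) (p : stars (twoStars a c h) ≡ 2) →
  secondStar (twoStars a c h) p ≡ c
secondStar-twoStars zero (suc c) h p = cong suc (starPos-unique (basis c) _ c (lookup-basis c))
secondStar-twoStars (suc a) (suc c) (s<s h) p = cong suc (secondStar-twoStars a c h p)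

-- Axes a < c are related by the generator of ⋖ coming from the 2-cell twoStars a c.
<⇒⋖ : ∀ {d} (u v : Q1 d) → axis u < axis v → u ⋖ v
<⇒⋖ u v h =
  step q (same-axis⇒≈ u (s q (suc zero)) (sym (trans (axis-s₂ q) (firstStar-twoStars a c h r))))
         (same-axis⇒≈ (s q zero) v (trans (axis-s₁ q) (secondStar-twoStars a c h r)))
  where
  a = axis u
  c = axis v
  r = stars-twoStars a c h
  q : Q2 _
  q = twoStars a c h , r

lemma3p2 : (d : ℕ) → 1 ≤ d →
    ((u v : Q1 d) (k l : Fin d) → lookup (proj₁ u) k ≡ star → lookup (proj₁ v) l ≡ star →
    (u ≈ v ⇔ k ≡ l))
    × Σ (Q1 d → Fin d) (λ f →
    ((u : Q1 d) → lookup (proj₁ u) (f u) ≡ star)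
    × ((u v : Q1 d) → (u ≈ v ⇔ f u ≡ f v))
    × ((k : Fin d) → ∃ (λ u → f u ≡ k))
    × ((u v : Q1 d) → (u ⋖ v ⇔ f u < f v)))
lemma3p2 d _ =
  (λ u v k l u[k]≡∗ v[l]≡∗ →
    subst₂ (λ a b → u ≈ v ⇔ a ≡ b)
      (starPos-unique _ _ k u[k]≡∗) (starPos-unique _ _ l v[l]≡∗) (≈⇔same-axis u v)) ,
  axis ,
  (λ u → lookup-starPos (proj₁ u) (proj₂ u)) ,
  ≈⇔same-axis ,
  (λ k → (basis k , stars-basis k) , starPos-unique _ _ k (lookup-basis k)) ,
  (λ u v → mk⇔ ⋖⇒< (<⇒⋖ u v))
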